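{- For every $\sigma \in S_3$ and every positive integer $f$, there exists a permutation $\pi$ (of some size $m \ge 1$) such that $|\mathrm{SC}_\sigma^{ -1}(\pi)| = f$. That is, every positive integer is a fertility number of $\mathrm{SC}_\sigma$.
   Context: For a permutation $\tau=\tau_1\cdots\tau_m\in S_m$ and a pattern $\sigma\in S_3$, the consecutive-pattern-avoiding stack-sorting map $\mathrm{SC}_\sigma$ is defined as follows. Read $\tau$ from left to right, using a stack that starts empty. At each step, let $x$ be the next unread entry of the input. If the stack has fewer than two entries, or if pushing $x$ would not make the top three entries of the stack, read from top to bottom, have the same relative order as $\sigma$, then push $x$ onto the stack. Otherwise, pop the top entry of the stack and append it to the output. Once the whole input has been read, pop all remaining entries one at a time from the top and append them to the output. The output permutation is $\mathrm{SC}_\sigma(\tau)\in S_m$. For $\pi\in S_m$, $\mathrm{SC}_\sigma^{ -1}(\pi)=\{\tau\in S_m:\mathrm{SC}_\sigma(\tau)=\pi\}$. The fertility of $\pi$ is $|\mathrm{SC}_\sigma^{ -1}(\pi)|$. A positive integer $f$ is a fertility number of $\mathrm{SC}_\sigma$ if some permutation has fertility $f$. -}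

module Defs where

open import Data.Nat using (ℕ; suc; _<ᵇ_)
open import Data.Bool using (Bool; true; false; _∧_; if_then_else_)
open import Data.Bool.Properties using () renaming (_≟_ to _≟ᵇ_)
open import Data.List using (List; []; _∷_; _++_; map; length; upTo)
open import Data.Product using (_×_; _,_; Σ; proj₁; proj₂)
open import Relation.Nullary using (does)
open import Relation.Binary.PropositionalEquality using (_≡_)
open import Data.List.Relation.Binary.Permutation.Propositional using (_↭_)
open import Data.List.Relation.Unary.Unique.Propositional using (Unique)
open import Data.List.Membership.Propositional using (_∈_)
open import Function.Bundles using (_⇔_)

-- A permutation in S_m, in one-line notation: a list that is a rearrangement of 1,2,...,m.
IsPerm : ℕ → List ℕ → Set
IsPerm m τ = τ ↭ map suc (upTo m)

_==_ : Bool → Bool → Bool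
a == b = does (a ≟ᵇ b)

sameOrder : ℕ → ℕ → ℕ → ℕ → ℕ → ℕ → Bool
sameOrder w₁ w₂ w₃ s₁ s₂ s₃ =
  ((w₁ <ᵇ w₂) == (s₁ <ᵇ s₂)) ∧ ((w₂ <ᵇ w₁) == (s₂ <ᵇ s₁)) ∧
  ((w₁ <ᵇ w₃) == (s₁ <ᵇ s₃)) ∧ ((w₃ <ᵇ w₁) == (s₃ <ᵇ s₁)) ∧
  ((w₂ <ᵇ w₃) == (s₂ <ᵇ s₃)) ∧ ((w₃ <ᵇ w₂) == (s₃ <ᵇ s₂))

-- Would pushing x onto stack (x , a , b , ...) (top first) create the pattern σ
-- among the top three entries, read from top to bottom?
forms : List ℕ → ℕ → ℕ → ℕ → Bool
forms (s₁ ∷ s₂ ∷ s₃ ∷ []) x a b = sameOrder x a b s₁ s₂ s₃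
forms _ x a b = false

-- Handle the next input entry x with current stack (head = top):
-- pop entries while pushing x is forbidden, then push x.
-- Returns (popped entries in output order, new stack).
step : List ℕ → ℕ → List ℕ → List ℕ × List ℕ
step σ x (a ∷ b ∷ s) =
  if forms σ x a b
  then (let r = step σ x (b ∷ s) in (a ∷ proj₁ r , proj₂ r))
  else ([] , x ∷ a ∷ b ∷ s)
step σ x s = ([] , x ∷ s)

run : List ℕ → List ℕ → List ℕ → List ℕ
run σ s [] = s   -- pop remaining entries from the top
run σ s (x ∷ xs) = proj₁ (step σ x s) ++ run σ (proj₂ (step σ x s)) xs

SC : List ℕ → List ℕ → List ℕ
SC σ τ = run σ [] τ

-- π ∈ S_m has fertility f under SC_σ: the preimage set
-- { τ ∈ S_m : SC_σ(τ) = π } has exactly f elements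
-- (given as a duplicate-free list enumerating exactly that set).
HasFertility : List ℕ → ℕ → List ℕ → ℕ → Set
HasFertility σ m π f =
  Σ (List (List ℕ)) λ L →
    Unique L × (∀ τ → (τ ∈ L) ⇔ (IsPerm m τ × SC σ τ ≡ π)) × length L ≡ f

{-# OPTIONS --safe #-}
-- In each pop test the three entries involved are the incoming x, the top a and the
-- entry b below it, and σ decides which of them carries the middle value; the two patterns with
-- the same middle entry are mirror images under reversing the order of ℕ. So it suffices to treat
-- three kinds of patterns, each for an arbitrary strict order ≺, and to exhibit for every f ≥ 1 a
-- permutation with exactly f preimages. With r ≺-increasing of length f:
--   x ≺ b ≺ a :  π = c ∷ r with r ≺ c; the preimages are reverse v ++ c ∷ reverse u for r = u ++ v, v ≠ [];
--   a ≺ x ≺ b :  π = c ∷ e ∷ r with c ≺ r ≺ e; the preimages are reverse r ++ e ∷ c ∷ [] and the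
--                lists above with u ≠ [], followed by e;
--   b ≺ a ≺ x :  π = r ++ z ∷ [] with z ≺ r; the preimages are z ∷ u ++ reverse v for r = u ++ v, v ≠ [].
-- Completeness of these lists comes from locating the first pop of the stack.
module Submission where

open import Defs
open import Data.Bool using (Bool; true; false; T)
open import Data.Bool.Properties using (T-∧; T?)
open import Data.Empty using (⊥-elim)
open import Data.List using (List; []; _∷_; _++_; _ʳ++_; [_]; _∷ʳ_; reverse; length; map; upTo; downFrom)
open import Data.List.Properties
  using (++-identityʳ; ++-assoc; ʳ++-defn; ʳ++-ʳ++; ++-ʳ++; reverse-involutive; unfold-reverse;
         reverse-map; reverse-upTo; upTo-∷ʳ; map-upTo; map-applyUpTo; map-++; length-upTo; length-downFrom;
         ∷-injective; ∷-injectiveˡ; ∷-injectiveʳ; ∷ʳ-injective; ∷ʳ-injectiveˡ; ∷ʳ-injectiveʳ; length-map)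
open import Data.List.Membership.Propositional using (_∈_; _∉_)
open import Data.List.Membership.Propositional.Properties
  using (∈-map⁺; ∈-map⁻; ∈-++⁺ˡ; ∈-++⁺ʳ; ∈-++⁻; ∈-upTo⁻; ∈-downFrom⁻)
open import Data.List.Relation.Binary.Permutation.Propositional
  using (_↭_; prep; swap; ↭-refl; ↭-sym; ↭-trans; ↭-reflexive; module PermutationReasoning)
open import Data.List.Relation.Binary.Permutation.Propositional.Properties
  using (shift; ++⁺ˡ; ++⁺ʳ; ∈-resp-↭; drop-∷; drop-mid; ∷↭∷ʳ; ¬x∷xs↭[]; ↭-reverse; ↭-singleton-inv; ↭-length)
open import Data.List.Relation.Unary.All as All using (All; []; _∷_)
open import Data.List.Relation.Unary.AllPairs as AllPairs using (AllPairs; []; _∷_)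
open import Data.List.Relation.Unary.Any using (here; there)
open import Data.List.Relation.Unary.Linked as Linked using (Linked; _∷_)
open import Data.List.Relation.Unary.Linked.Properties
  using (AllPairs⇒Linked; Linked⇒AllPairs; applyUpTo⁺₂; applyDownFrom⁺₂)
  renaming (map⁺ to Linked-map⁺)
open import Data.List.Relation.Unary.Unique.Propositional using (Unique)
import Data.List.Relation.Unary.Unique.Propositional.Properties as Unique
open import Data.Nat using (ℕ; suc; _+_; _<_; _>_; _<ᵇ_; _<?_; _≤_; z≤n; s≤s)
open import Data.Nat.Properties using (<-trans; <-asym; <ᵇ⇒<; +-monoʳ-<; n<1+n; m≤m+n; <-isStrictPartialOrder)
open import Data.Product using (Σ; _×_; _,_; proj₁; proj₂; ∃-syntax)
open import Data.Sum using (_⊎_; inj₁; inj₂)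
open import Function using (_∘_; id; case_of_)
open import Function.Bundles using (_⇔_; mk⇔; Equivalence)
open import Level using (0ℓ)
open import Relation.Binary using (Rel; IsStrictPartialOrder)
import Relation.Binary.Construct.Flip.EqAndOrd as Flip
open import Relation.Binary.PropositionalEquality
  using (_≡_; _≢_; refl; sym; trans; cong; subst; subst₂; module ≡-Reasoning)
open import Relation.Nullary using (¬_; yes; no)
open import Relation.Nullary.Decidable using (dec-true; dec-false)

open Equivalence using (to; from)

reverse-≡ : ∀ {xs ys : List ℕ} → ys ≡ reverse xs → xs ≡ reverse ys
reverse-≡ {xs} eq = trans (sym (reverse-involutive xs)) (cong reverse (sym eq))

ʳ++-++ : ∀ (xs ys zs : List ℕ) → (xs ʳ++ ys) ++ zs ≡ xs ʳ++ (ys ++ zs)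
ʳ++-++ xs ys zs = begin
  (xs ʳ++ ys) ++ zs        ≡⟨ cong (_++ zs) (ʳ++-defn xs) ⟩
  (reverse xs ++ ys) ++ zs ≡⟨ ++-assoc (reverse xs) ys zs ⟩
  reverse xs ++ ys ++ zs   ≡⟨ ʳ++-defn xs ⟨
  xs ʳ++ (ys ++ zs)        ∎
  where open ≡-Reasoning

Linked-ʳ++⁻ʳ : ∀ {R : Rel ℕ 0ℓ} xs {ys} → Linked R (xs ʳ++ ys) → Linked R ys
Linked-ʳ++⁻ʳ []       h = h
Linked-ʳ++⁻ʳ (x ∷ xs) h = Linked.tail (Linked-ʳ++⁻ʳ xs h)

All-ʳ++⁻ʳ : ∀ {P : ℕ → Set} xs {ys} → All P (xs ʳ++ ys) → All P ys
All-ʳ++⁻ʳ []       h = h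
All-ʳ++⁻ʳ (x ∷ xs) h = All.tail (All-ʳ++⁻ʳ xs h)

∷ʳ-as-∷ : ∀ (w : List ℕ) h → ∃[ x ] ∃[ w′ ] w ∷ʳ h ≡ x ∷ w′
∷ʳ-as-∷ []      h = h , [] , refl
∷ʳ-as-∷ (x ∷ w) h = x , w ∷ʳ h , refl

ʳ++-second : ∀ ys {p q a b : ℕ} {r s} → ys ʳ++ (p ∷ q ∷ r) ≡ a ∷ b ∷ s →
             (ys ≡ [] × a ≡ p × b ≡ q × s ≡ r) ⊎ b ∈ p ∷ ys
ʳ++-second []       refl = inj₁ (refl , refl , refl , refl)
ʳ++-second (y ∷ ys) eq with ʳ++-second ys eq
... | inj₁ (_ , _ , refl , _) = inj₂ (here refl)
... | inj₂ b∈y∷ys           = inj₂ (there b∈y∷ys)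

ʳ++-head : ∀ xs (y : ℕ) ys → ∃[ x ] ∃[ rest ] xs ʳ++ (y ∷ ys) ≡ x ∷ rest × x ∈ y ∷ xs
ʳ++-head []       y ys = y , ys , refl , here refl
ʳ++-head (x ∷ xs) y ys with x′ , rest , eq , x′∈ ← ʳ++-head xs x (y ∷ ys) = x′ , rest , eq , there x′∈

-- Recognising the patterns

Agree : ℕ → ℕ → ℕ → ℕ → Set
Agree u v s t = T ((u <ᵇ v) == (s <ᵇ t)) × T ((v <ᵇ u) == (t <ᵇ s))

==⇒≡ : ∀ p q → T (p == q) → p ≡ q
==⇒≡ false false _ = refl
==⇒≡ true  true  _ = refl

≡⇒== : ∀ {p q} → p ≡ q → T (p == q)
≡⇒== {false} refl = _
≡⇒== {true}  refl = _

sameOrder⇔ : ∀ w₁ w₂ w₃ s₁ s₂ s₃ → T (sameOrder w₁ w₂ w₃ s₁ s₂ s₃) ⇔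
             (Agree w₁ w₂ s₁ s₂ × Agree w₁ w₃ s₁ s₃ × Agree w₂ w₃ s₂ s₃)
sameOrder⇔ _ _ _ _ _ _ = mk⇔
  (λ h → let (e₁ , h) = T-∧ .to h ; (e₂ , h) = T-∧ .to h ; (e₃ , h) = T-∧ .to h
             (e₄ , h) = T-∧ .to h ; (e₅ , e₆) = T-∧ .to h
         in (e₁ , e₂) , (e₃ , e₄) , (e₅ , e₆))
  (λ ((e₁ , e₂) , (e₃ , e₄) , (e₅ , e₆)) →
    T-∧ .from (e₁ , T-∧ .from (e₂ , T-∧ .from (e₃ , T-∧ .from (e₄ , T-∧ .from (e₅ , e₆))))))

-- For distinct literals s and t, Agree u v s t normalises to Agree u v 0 1 or Agree u v 1 0, so
-- the next two lemmas apply to every comparison that sameOrder makes against a concrete pattern.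
<⇔Agree : ∀ {u v} → u < v ⇔ Agree u v 0 1
<⇔Agree {u} {v} = mk⇔
  (λ u<v → ≡⇒== (dec-true (u <? v) u<v) , ≡⇒== (dec-false (v <? u) (<-asym u<v)))
  (λ (e , _) → <ᵇ⇒< u v (subst T (sym (==⇒≡ _ true e)) _))

>⇔Agree : ∀ {u v} → u > v ⇔ Agree u v 1 0
>⇔Agree {u} {v} = mk⇔
  (λ u>v → ≡⇒== (dec-false (u <? v) (<-asym u>v)) , ≡⇒== (dec-true (v <? u) u>v))
  (λ (_ , e) → <ᵇ⇒< v u (subst T (sym (==⇒≡ _ true e)) _))

σ132 σ312 σ213 σ231 σ321 σ123 : List ℕ
σ132 = 1 ∷ 3 ∷ 2 ∷ []
σ312 = 3 ∷ 1 ∷ 2 ∷ []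
σ213 = 2 ∷ 1 ∷ 3 ∷ []
σ231 = 2 ∷ 3 ∷ 1 ∷ []
σ321 = 3 ∷ 2 ∷ 1 ∷ []
σ123 = 1 ∷ 2 ∷ 3 ∷ []

forms-132 : ∀ {x a b} → T (forms σ132 x a b) ⇔ (x < b × b < a)
forms-132 {x} {a} {b} = mk⇔
  (λ h → let (_ , xb , ab) = sameOrder⇔ x a b 1 3 2 .to h in <⇔Agree .from xb , >⇔Agree .from ab)
  (λ (x<b , b<a) → sameOrder⇔ x a b 1 3 2 .from
    (<⇔Agree .to (<-trans x<b b<a) , <⇔Agree .to x<b , >⇔Agree .to b<a))

forms-312 : ∀ {x a b} → T (forms σ312 x a b) ⇔ (x > b × b > a)
forms-312 {x} {a} {b} = mk⇔
  (λ h → let (_ , xb , ab) = sameOrder⇔ x a b 3 1 2 .to h in >⇔Agree .from xb , <⇔Agree .from ab)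
  (λ (x>b , b>a) → sameOrder⇔ x a b 3 1 2 .from
    (>⇔Agree .to (<-trans b>a x>b) , >⇔Agree .to x>b , <⇔Agree .to b>a))

forms-213 : ∀ {x a b} → T (forms σ213 x a b) ⇔ (a < x × x < b)
forms-213 {x} {a} {b} = mk⇔
  (λ h → let (xa , xb , _) = sameOrder⇔ x a b 2 1 3 .to h in >⇔Agree .from xa , <⇔Agree .from xb)
  (λ (a<x , x<b) → sameOrder⇔ x a b 2 1 3 .from
    (>⇔Agree .to a<x , <⇔Agree .to x<b , <⇔Agree .to (<-trans a<x x<b)))

forms-231 : ∀ {x a b} → T (forms σ231 x a b) ⇔ (a > x × x > b)
forms-231 {x} {a} {b} = mk⇔
  (λ h → let (xa , xb , _) = sameOrder⇔ x a b 2 3 1 .to h in <⇔Agree .from xa , >⇔Agree .from xb)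
  (λ (a>x , x>b) → sameOrder⇔ x a b 2 3 1 .from
    (<⇔Agree .to a>x , >⇔Agree .to x>b , >⇔Agree .to (<-trans x>b a>x)))

forms-321 : ∀ {x a b} → T (forms σ321 x a b) ⇔ (b < a × a < x)
forms-321 {x} {a} {b} = mk⇔
  (λ h → let (xa , _ , ab) = sameOrder⇔ x a b 3 2 1 .to h in >⇔Agree .from ab , >⇔Agree .from xa)
  (λ (b<a , a<x) → sameOrder⇔ x a b 3 2 1 .from
    (>⇔Agree .to a<x , >⇔Agree .to (<-trans b<a a<x) , >⇔Agree .to b<a))

forms-123 : ∀ {x a b} → T (forms σ123 x a b) ⇔ (b > a × a > x)
forms-123 {x} {a} {b} = mk⇔
  (λ h → let (xa , _ , ab) = sameOrder⇔ x a b 1 2 3 .to h in <⇔Agree .from ab , <⇔Agree .from xa)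
  (λ (b>a , a>x) → sameOrder⇔ x a b 1 2 3 .from
    (<⇔Agree .to a>x , <⇔Agree .to (<-trans a>x b>a) , <⇔Agree .to b>a))

-- The stack machine

-- Stacks are lists with the top first, so pushing xs onto s without a pop leaves xs ʳ++ s.
module StackSorting (σ : List ℕ) where

  blocked : ℕ → List ℕ → Bool
  blocked x (a ∷ b ∷ _) = forms σ x a b
  blocked x _           = false

  run-push : ∀ x s xs → ¬ T (blocked x s) → run σ s (x ∷ xs) ≡ run σ (x ∷ s) xs
  run-push x []          xs _ = refl
  run-push x (_ ∷ [])    xs _ = refl
  run-push x (a ∷ b ∷ _) xs ¬pop with forms σ x a b
  ... | false = refl
  ... | true  = ⊥-elim (¬pop _)

  run-pop : ∀ x a b s xs → T (forms σ x a b) → run σ (a ∷ b ∷ s) (x ∷ xs) ≡ a ∷ run σ (b ∷ s) (x ∷ xs)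
  run-pop x a b s xs _ with forms σ x a b
  ... | true = refl

  ↭-step : ∀ x s → proj₁ (step σ x s) ++ proj₂ (step σ x s) ↭ x ∷ s
  ↭-step x (a ∷ b ∷ s) with forms σ x a b | ↭-step x (b ∷ s)
  ... | true  | ih = ↭-trans (prep a ih) (swap a x ↭-refl)
  ... | false | _  = ↭-refl
  ↭-step x []       = ↭-refl
  ↭-step x (_ ∷ []) = ↭-refl

  run-↭ : ∀ s xs → run σ s xs ↭ s ++ xs
  run-↭ s [] = ↭-reflexive (sym (++-identityʳ s))
  run-↭ s (x ∷ xs) = begin
    popped ++ run σ stack xs  ↭⟨ ++⁺ˡ popped (run-↭ stack xs) ⟩
    popped ++ stack ++ xs     ≡⟨ ++-assoc popped stack xs ⟨
    (popped ++ stack) ++ xs   ↭⟨ ++⁺ʳ xs (↭-step x s) ⟩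
    x ∷ s ++ xs               ↭⟨ shift x s xs ⟨
    s ++ x ∷ xs               ∎
    where
    open PermutationReasoning
    popped stack : List ℕ
    popped = proj₁ (step σ x s)
    stack  = proj₂ (step σ x s)

  ∈-run : ∀ {y} s xs → y ∈ s ++ xs → y ∈ run σ s xs
  ∈-run s xs = ∈-resp-↭ (↭-sym (run-↭ s xs))

  step-∷ʳ : ∀ x s z → ∃[ s′ ] proj₂ (step σ x (s ∷ʳ z)) ≡ s′ ∷ʳ z
  step-∷ʳ x [] z = [ x ] , refl
  step-∷ʳ x (a ∷ []) z with forms σ x a z
  ... | true  = [ x ] , refl
  ... | false = x ∷ a ∷ [] , refl
  step-∷ʳ x (a ∷ b ∷ s) z with forms σ x a b | step-∷ʳ x (b ∷ s) z
  ... | true  | ih = ih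
  ... | false | _  = x ∷ a ∷ b ∷ s , refl

  run-∷ʳ : ∀ s z xs → ∃[ w ] run σ (s ∷ʳ z) xs ≡ w ∷ʳ z
  run-∷ʳ s z [] = s , refl
  run-∷ʳ s z (x ∷ xs) with step σ x (s ∷ʳ z) | step-∷ʳ x s z
  ... | popped , _ | s′ , refl with run-∷ʳ s′ z xs
  ... | w , eq = popped ++ w , trans (cong (popped ++_) eq) (sym (++-assoc popped w [ z ]))

  data NoPop : List ℕ → List ℕ → Set where
    []  : ∀ {s} → NoPop s []
    _∷_ : ∀ {x s xs} → ¬ T (blocked x s) → NoPop (x ∷ s) xs → NoPop s (x ∷ xs)

  run-noPop : ∀ {s xs} ys → NoPop s xs → run σ s (xs ++ ys) ≡ run σ (xs ʳ++ s) ys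
  run-noPop ys [] = refl
  run-noPop {s} {x ∷ xs} ys (p ∷ ps) = trans (run-push x s (xs ++ ys) p) (run-noPop ys ps)

  run-noPop-all : ∀ {s xs} → NoPop s xs → run σ s xs ≡ xs ʳ++ s
  run-noPop-all {s} {xs} p = trans (cong (run σ s) (sym (++-identityʳ xs))) (run-noPop [] p)

  module _ {R : Rel ℕ 0ℓ} where

    unblocked : (∀ {x a b} → R a b → ¬ T (forms σ x a b)) → ∀ {x s} → Linked R s → ¬ T (blocked x s)
    unblocked ¬pop (Rab ∷ _) = ¬pop Rab

    noPop-stack : (∀ {x a b} → R a b → ¬ T (forms σ x a b)) → ∀ {s} xs → Linked R (xs ʳ++ s) → NoPop s xs
    noPop-stack ¬pop []       _ = []
    noPop-stack ¬pop (x ∷ xs) h = unblocked ¬pop (Linked.tail (Linked-ʳ++⁻ʳ xs h)) ∷ noPop-stack ¬pop xs h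

    unblocked-below : (∀ {x a b} → R x a → ¬ T (forms σ x a b)) → ∀ {x a} s → R x a → ¬ T (blocked x (a ∷ s))
    unblocked-below ¬pop (_ ∷ _) Rxa = ¬pop Rxa

    noPop-incoming : (∀ {x a b} → R x a → ¬ T (forms σ x a b)) →
                     ∀ {a s s′} xs → Linked R (xs ʳ++ (a ∷ s′)) → NoPop (a ∷ s) xs
    noPop-incoming ¬pop       []       _ = []
    noPop-incoming ¬pop {s = s} (x ∷ xs) h =
      unblocked-below ¬pop s (Linked.head (Linked-ʳ++⁻ʳ xs h)) ∷ noPop-incoming ¬pop xs h

    noPop-fresh : (∀ {x a b} → R x a → ¬ T (forms σ x a b)) →
                  ∀ {s} → (∀ {x} → ¬ T (blocked x s)) → ∀ xs → Linked R (reverse xs) → NoPop s xs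
    noPop-fresh ¬pop short []       _ = []
    noPop-fresh ¬pop short (x ∷ xs) h = short ∷ noPop-incoming ¬pop {s′ = []} xs h

  run-ʳ++ : ∀ v ys → NoPop [] (reverse v) → run σ [] (v ʳ++ ys) ≡ run σ v ys
  run-ʳ++ v ys p = begin
    run σ [] (v ʳ++ ys)              ≡⟨ cong (run σ []) (ʳ++-defn v) ⟩
    run σ [] (reverse v ++ ys)       ≡⟨ run-noPop ys p ⟩
    run σ (reverse (reverse v)) ys   ≡⟨ cong (λ st → run σ st ys) (reverse-involutive v) ⟩
    run σ v ys                       ∎
    where open ≡-Reasoning

  data FirstPop (s xs out : List ℕ) : Set where
    no-pop : out ≡ xs ʳ++ s → FirstPop s xs out
    pop    : ∀ ys x zs a b s′ → xs ≡ ys ++ x ∷ zs → ys ʳ++ s ≡ a ∷ b ∷ s′ → T (forms σ x a b) →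
             out ≡ a ∷ run σ (b ∷ s′) (x ∷ zs) → FirstPop s xs out

  private
    pushed : ∀ {x s xs} → ¬ T (blocked x s) → FirstPop (x ∷ s) xs (run σ (x ∷ s) xs) →
             FirstPop s (x ∷ xs) (run σ s (x ∷ xs))
    pushed {x} {s} {xs} ¬pop (no-pop e) = no-pop (trans (run-push x s xs ¬pop) e)
    pushed {x} {s} {xs} ¬pop (pop ys y zs a b s′ e₁ e₂ p e₃) =
      pop (x ∷ ys) y zs a b s′ (cong (x ∷_) e₁) e₂ p (trans (run-push x s xs ¬pop) e₃)

    firstPop-run : ∀ s xs → FirstPop s xs (run σ s xs)
    firstPop-run s [] = no-pop refl
    firstPop-run [] (x ∷ xs) = pushed (λ ()) (firstPop-run [ x ] xs)
    firstPop-run (a ∷ []) (x ∷ xs) = pushed (λ ()) (firstPop-run (x ∷ a ∷ []) xs)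
    firstPop-run (a ∷ b ∷ s) (x ∷ xs) with T? (forms σ x a b)
    ... | yes p  = pop [] x xs a b s refl refl p (run-pop x a b s xs p)
    ... | no ¬p = pushed ¬p (firstPop-run (x ∷ a ∷ b ∷ s) xs)

  firstPop : ∀ s xs {out} → run σ s xs ≡ out → FirstPop s xs out
  firstPop s xs refl = firstPop-run s xs

  hasFertility : ∀ {m π} (L : List (List ℕ)) → Unique L → IsPerm m π →
                 (∀ {τ} → τ ∈ L → SC σ τ ≡ π) → (∀ {τ} → SC σ τ ≡ π → τ ∈ L) →
                 HasFertility σ m π (length L)
  hasFertility {m} {π} L unique π-perm sound complete =
    L , unique , (λ τ → mk⇔ (λ τ∈L → isPerm (sound τ∈L) , sound τ∈L) (λ (_ , eq) → complete eq)) , refl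
    where
    isPerm : ∀ {τ} → SC σ τ ≡ π → IsPerm m τ
    isPerm {τ} eq = ↭-trans (↭-sym (run-↭ [] τ)) (subst (_↭ _) (sym eq) π-perm)

-- Preimage lists

revInsertions : ℕ → List ℕ → List (List ℕ)
revInsertions c []      = []
revInsertions c (h ∷ t) = ((h ∷ t) ʳ++ [ c ]) ∷ map (_∷ʳ h) (revInsertions c t)

length-revInsertions : ∀ c r → length (revInsertions c r) ≡ length r
length-revInsertions c []      = refl
length-revInsertions c (h ∷ t) =
  cong suc (trans (length-map (_∷ʳ h) (revInsertions c t)) (length-revInsertions c t))

revInsertions-unique : ∀ {c r} → c ∉ r → Unique (revInsertions c r)
revInsertions-unique {c} {[]}    _   = []
revInsertions-unique {c} {h ∷ t} c∉r =
  All.tabulate head≢ ∷ Unique.map⁺ (λ {u} {v} → proj₁ ∘ ∷ʳ-injective u v) (revInsertions-unique (c∉r ∘ there))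
  where
  head≢ : ∀ {τ} → τ ∈ map (_∷ʳ h) (revInsertions c t) → (h ∷ t) ʳ++ [ c ] ≢ τ
  head≢ τ∈ eq with _ , _ , refl ← ∈-map⁻ (_∷ʳ h) τ∈ =
    c∉r (here (proj₂ (∷ʳ-injective (reverse (h ∷ t)) _ (trans (sym (ʳ++-defn (h ∷ t))) eq))))

∈-revInsertions⁻ : ∀ {c r τ} → τ ∈ revInsertions c r →
                   ∃[ w ] ∃[ b ] ∃[ s ] r ≡ w ʳ++ (b ∷ s) × τ ≡ (b ∷ s) ʳ++ (c ∷ w)
∈-map∷ʳ-revInsertions⁻ : ∀ {c h t τ} → τ ∈ map (_∷ʳ h) (revInsertions c t) →
  ∃[ x ] ∃[ w ] ∃[ b ] ∃[ s ] h ∷ t ≡ (x ∷ w) ʳ++ (b ∷ s) × τ ≡ (b ∷ s) ʳ++ (c ∷ x ∷ w)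

∈-revInsertions⁻ {r = h ∷ t} (here refl) = [] , h , t , refl , refl
∈-revInsertions⁻ {r = h ∷ t} (there τ∈) with x , w , b , s , r≡ , τ≡ ← ∈-map∷ʳ-revInsertions⁻ τ∈ =
  x ∷ w , b , s , r≡ , τ≡

∈-map∷ʳ-revInsertions⁻ {c} {h} τ∈
  with τ′ , τ′∈ , refl ← ∈-map⁻ (_∷ʳ h) τ∈
  with w , b , s , refl , refl ← ∈-revInsertions⁻ τ′∈
  with x , w′ , w∷ʳh≡ ← ∷ʳ-as-∷ w h =
  x , w′ , b , s ,
  trans (sym (++-ʳ++ w)) (cong (_ʳ++ (b ∷ s)) w∷ʳh≡) ,
  trans (ʳ++-++ (b ∷ s) (c ∷ w) [ h ]) (cong (λ v → (b ∷ s) ʳ++ (c ∷ v)) w∷ʳh≡)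

module _ {c : ℕ} where

  private
    ∈-revInsertions-++⁺ : ∀ u b s → (b ∷ s) ʳ++ (c ∷ reverse u) ∈ revInsertions c (u ++ b ∷ s)

  ∈-map∷ʳ-revInsertions⁺ : ∀ h u b s →
    (b ∷ s) ʳ++ (c ∷ reverse (h ∷ u)) ∈ map (_∷ʳ h) (revInsertions c (u ++ b ∷ s))
  ∈-map∷ʳ-revInsertions⁺ h u b s =
    subst (_∈ map (_∷ʳ h) (revInsertions c (u ++ b ∷ s)))
          (trans (ʳ++-++ (b ∷ s) (c ∷ reverse u) [ h ])
                 (cong (λ v → (b ∷ s) ʳ++ (c ∷ v)) (sym (unfold-reverse h u))))
          (∈-map⁺ (_∷ʳ h) (∈-revInsertions-++⁺ u b s))

  ∈-revInsertions-++⁺ []      b s = here refl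
  ∈-revInsertions-++⁺ (h ∷ u) b s = there (∈-map∷ʳ-revInsertions⁺ h u b s)

  ∈-revInsertions⁺ : ∀ w b s → (b ∷ s) ʳ++ (c ∷ w) ∈ revInsertions c (w ʳ++ (b ∷ s))
  ∈-revInsertions⁺ w b s =
    subst₂ (λ v r → (b ∷ s) ʳ++ (c ∷ v) ∈ revInsertions c r) (reverse-involutive w) (sym (ʳ++-defn w))
           (∈-revInsertions-++⁺ (reverse w) b s)

suffixReversals : List ℕ → List (List ℕ)
suffixReversals []      = []
suffixReversals (h ∷ t) = reverse (h ∷ t) ∷ map (h ∷_) (suffixReversals t)

length-suffixReversals : ∀ r → length (suffixReversals r) ≡ length r
length-suffixReversals []      = refl
length-suffixReversals (h ∷ t) =
  cong suc (trans (length-map (h ∷_) (suffixReversals t)) (length-suffixReversals t))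

∈-suffixReversals-head : ∀ {r w} → w ∈ suffixReversals r → ∃[ x ] ∃[ w′ ] w ≡ x ∷ w′ × x ∈ r
∈-suffixReversals-head {h ∷ t} (here refl) = ʳ++-head t h []
∈-suffixReversals-head {h ∷ t} (there w∈) with w′ , _ , refl ← ∈-map⁻ (h ∷_) w∈ = h , w′ , refl , here refl

suffixReversals-unique : ∀ {r} → Unique r → Unique (suffixReversals r)
suffixReversals-unique {[]}        _              = []
suffixReversals-unique {h ∷ []}    _              = [] ∷ []
suffixReversals-unique {h ∷ t@(_ ∷ _)} (h∉t ∷ t-uniq) =
  All.tabulate head≢ ∷ Unique.map⁺ ∷-injectiveʳ (suffixReversals-unique t-uniq)
  where
  last-∈ : ∀ P → h ∷ t ≡ P ++ [ h ] → h ∈ t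
  last-∈ []      ()
  last-∈ (_ ∷ P) eq = subst (h ∈_) (sym (∷-injectiveʳ eq)) (∈-++⁺ʳ P (here refl))
  head≢ : ∀ {w} → w ∈ map (h ∷_) (suffixReversals t) → reverse (h ∷ t) ≢ w
  head≢ w∈ eq with w′ , _ , refl ← ∈-map⁻ (h ∷_) w∈ =
    All.lookup h∉t (last-∈ (reverse w′) (trans (reverse-≡ (sym eq)) (ʳ++-defn w′))) refl

-- Three kinds of patterns

module MiddleSecond {_≺_ : Rel ℕ 0ℓ} (≺-spo : IsStrictPartialOrder _≡_ _≺_)
  (σ : List ℕ) (pops⇔ : ∀ {x a b} → T (forms σ x a b) ⇔ (x ≺ b × b ≺ a))
  {c h : ℕ} {t : List ℕ} (sorted : AllPairs _≺_ (h ∷ t)) (below-c : All (_≺ c) (h ∷ t)) where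

  open IsStrictPartialOrder ≺-spo using (asym; irrefl)
  open StackSorting σ

  r : List ℕ
  r = h ∷ t

  ¬pop : ∀ {x a b} → a ≺ b → ¬ T (forms σ x a b)
  ¬pop a≺b p = asym a≺b (proj₂ (pops⇔ .to p))

  linked : Linked _≺_ r
  linked = AllPairs⇒Linked sorted

  ordered-stack : ∀ {v} → Linked _≺_ v → NoPop [] (reverse v)
  ordered-stack {v} v-linked =
    noPop-stack ¬pop (reverse v) (subst (Linked _≺_) (sym (reverse-involutive v)) v-linked)

  sound : ∀ {τ} → τ ∈ revInsertions c r → SC σ τ ≡ c ∷ r
  sound τ∈ with w , b , s , r≡ , refl ← ∈-revInsertions⁻ τ∈ = begin
    run σ [] ((b ∷ s) ʳ++ (c ∷ w))  ≡⟨ run-ʳ++ (b ∷ s) (c ∷ w) (ordered-stack bs-linked) ⟩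
    run σ (b ∷ s) (c ∷ w)           ≡⟨ run-push c (b ∷ s) w (unblocked ¬pop bs-linked) ⟩
    run σ (c ∷ b ∷ s) w             ≡⟨ pop-c w r≡ ⟩
    c ∷ r                           ∎
    where
    open ≡-Reasoning
    bs-linked : Linked _≺_ (b ∷ s)
    bs-linked = Linked-ʳ++⁻ʳ w (subst (Linked _≺_) r≡ linked)
    pop-c : ∀ w → r ≡ w ʳ++ (b ∷ s) → run σ (c ∷ b ∷ s) w ≡ c ∷ r
    pop-c [] r≡ = cong (c ∷_) (sym r≡)
    pop-c (x ∷ w) r≡ = begin
      run σ (c ∷ b ∷ s) (x ∷ w)    ≡⟨ run-pop x c b s w (pops⇔ .from (x≺b , b≺c)) ⟩
      c ∷ run σ (b ∷ s) (x ∷ w)    ≡⟨ cong (c ∷_) (run-noPop-all (noPop-stack ¬pop (x ∷ w) r-linked)) ⟩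
      c ∷ (x ∷ w) ʳ++ (b ∷ s)      ≡⟨ cong (c ∷_) r≡ ⟨
      c ∷ r                        ∎
      where
      r-linked : Linked _≺_ ((x ∷ w) ʳ++ (b ∷ s))
      r-linked = subst (Linked _≺_) r≡ linked
      x≺b : x ≺ b
      x≺b = Linked.head (Linked-ʳ++⁻ʳ w r-linked)
      b≺c : b ≺ c
      b≺c = All.head (All-ʳ++⁻ʳ (x ∷ w) (subst (All (_≺ c)) r≡ below-c))

  complete : ∀ {τ} → SC σ τ ≡ c ∷ r → τ ∈ revInsertions c r
  complete {τ} eq with firstPop [] τ eq
  ... | no-pop out≡ = subst (_∈ revInsertions c r) (sym (reverse-≡ out≡)) (here refl)
  ... | pop ys x zs a b s′ τ≡ stack≡ _ out≡ with refl , r≡ ← ∷-injective out≡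
    with firstPop (b ∷ s′) (x ∷ zs) (sym r≡)
  ... | no-pop r≡′ = subst₂ _∈_ (sym τ≡′) (cong (revInsertions c) (sym r≡′)) (∈-revInsertions⁺ (x ∷ zs) b s′)
    where
    τ≡′ : τ ≡ (b ∷ s′) ʳ++ (c ∷ x ∷ zs)
    τ≡′ = trans τ≡ (trans (cong (_++ x ∷ zs) (reverse-≡ (sym stack≡))) (ʳ++-++ (b ∷ s′) [ c ] (x ∷ zs)))
  -- A second pop would put a′ before the deeper b′ in r, although it needs b′ ≺ a′.
  ... | pop _ x′ zs′ a′ b′ s″ _ _ p′ r≡′ =
    ⊥-elim (¬pop (All.lookup (AllPairs.head (subst (AllPairs _≺_) r≡′ sorted))
                             (∈-run (b′ ∷ s″) (x′ ∷ zs′) (here refl))) p′)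

  fertility : ∀ {m} → IsPerm m (c ∷ r) → HasFertility σ m (c ∷ r) (length r)
  fertility {m} perm = subst (HasFertility σ m (c ∷ r)) (length-revInsertions c r)
    (hasFertility (revInsertions c r) (revInsertions-unique c∉r) perm sound complete)
    where
    c∉r : c ∉ r
    c∉r c∈r = irrefl refl (All.lookup below-c c∈r)

module MiddleIncoming {_≺_ : Rel ℕ 0ℓ} (≺-spo : IsStrictPartialOrder _≡_ _≺_)
  (σ : List ℕ) (pops⇔ : ∀ {x a b} → T (forms σ x a b) ⇔ (a ≺ x × x ≺ b))
  {c e h : ℕ} {t : List ℕ} (sorted : AllPairs _≺_ (h ∷ t))
  (c≺ : All (c ≺_) (h ∷ t)) (≺e : All (_≺ e) (h ∷ t)) where

  open IsStrictPartialOrder ≺-spo using (asym; irrefl) renaming (trans to ≺-trans)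
  open StackSorting σ

  r : List ℕ
  r = h ∷ t

  preimages : List (List ℕ)
  preimages = (r ʳ++ (e ∷ c ∷ [])) ∷ map (_∷ʳ e) (map (_∷ʳ h) (revInsertions c t))

  ¬pop : ∀ {x a b} → x ≺ a → ¬ T (forms σ x a b)
  ¬pop x≺a p = asym x≺a (proj₁ (pops⇔ .to p))

  linked : Linked _≺_ r
  linked = AllPairs⇒Linked sorted

  c≺e : c ≺ e
  c≺e = ≺-trans (All.head c≺) (All.head ≺e)

  e-unblocked : ∀ {s} → All (_≺ e) s → ¬ T (blocked e s)
  e-unblocked (_ ∷ b≺e ∷ _) p = asym b≺e (proj₂ (pops⇔ .to p))

  ordered-stack : ∀ {v} → Linked _≺_ v → NoPop [] (reverse v)
  ordered-stack {v} v-linked =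
    noPop-fresh ¬pop (λ ()) (reverse v) (subst (Linked _≺_) (sym (reverse-involutive v)) v-linked)

  sound : ∀ {τ} → τ ∈ preimages → SC σ τ ≡ c ∷ e ∷ r
  sound (here refl) = begin
    run σ [] (r ʳ++ (e ∷ c ∷ []))  ≡⟨ run-ʳ++ r (e ∷ c ∷ []) (ordered-stack linked) ⟩
    run σ r (e ∷ c ∷ [])           ≡⟨ run-push e r [ c ] (e-unblocked ≺e) ⟩
    run σ (e ∷ r) [ c ]            ≡⟨ run-push c (e ∷ r) [] (unblocked-below ¬pop r c≺e) ⟩
    c ∷ e ∷ r                      ∎
    where open ≡-Reasoning
  sound (there τ∈)
    with τ′ , τ′∈ , refl ← ∈-map⁻ (_∷ʳ e) τ∈
    with x , w , b , s , r≡ , refl ← ∈-map∷ʳ-revInsertions⁻ τ′∈ = begin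
    run σ [] (((b ∷ s) ʳ++ (c ∷ x ∷ w)) ∷ʳ e)  ≡⟨ cong (run σ []) (ʳ++-++ (b ∷ s) (c ∷ x ∷ w) [ e ]) ⟩
    run σ [] ((b ∷ s) ʳ++ (c ∷ x ∷ w ∷ʳ e))    ≡⟨ run-ʳ++ (b ∷ s) _ (ordered-stack (Linked.tail xbs-linked)) ⟩
    run σ (b ∷ s) (c ∷ x ∷ w ∷ʳ e)             ≡⟨ run-push c (b ∷ s) (x ∷ w ∷ʳ e) (unblocked-below ¬pop s c≺b) ⟩
    run σ (c ∷ b ∷ s) (x ∷ w ∷ʳ e)             ≡⟨ run-pop x c b s (w ∷ʳ e) (pops⇔ .from (c≺x , x≺b)) ⟩
    c ∷ run σ (b ∷ s) ((x ∷ w) ++ [ e ])       ≡⟨ cong (c ∷_) (run-noPop [ e ] pushes-w) ⟩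
    c ∷ run σ ((x ∷ w) ʳ++ (b ∷ s)) [ e ]      ≡⟨ cong (λ st → c ∷ run σ st [ e ]) r≡ ⟨
    c ∷ run σ r [ e ]                          ≡⟨ cong (c ∷_) (run-push e r [] (e-unblocked ≺e)) ⟩
    c ∷ e ∷ r                                  ∎
    where
    open ≡-Reasoning
    r-linked : Linked _≺_ ((x ∷ w) ʳ++ (b ∷ s))
    r-linked = subst (Linked _≺_) r≡ linked
    xbs-linked : Linked _≺_ (x ∷ b ∷ s)
    xbs-linked = Linked-ʳ++⁻ʳ w r-linked
    x≺b : x ≺ b
    x≺b = Linked.head xbs-linked
    pushes-w : NoPop (b ∷ s) (x ∷ w)
    pushes-w = noPop-incoming ¬pop (x ∷ w) r-linked
    c≺xbs : All (c ≺_) (x ∷ b ∷ s)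
    c≺xbs = All-ʳ++⁻ʳ w (subst (All (c ≺_)) r≡ c≺)
    c≺x : c ≺ x
    c≺x = All.head c≺xbs
    c≺b : c ≺ b
    c≺b = All.head (All.tail c≺xbs)

  -- P is the input read after c is popped, reversed; it is not just e, as e does not pop c off b.
  private
    inner-preimage : ∀ {τ x zs b s′} P → τ ≡ (b ∷ s′) ʳ++ (c ∷ x ∷ zs) → T (forms σ x c b) →
                     e ∷ r ≡ P ++ b ∷ s′ → x ∷ zs ≡ reverse P → τ ∈ preimages
    inner-preimage [] _ _ _ ()
    inner-preimage (_ ∷ []) _ p r≡ refl
      with refl ← ∷-injectiveˡ r≡ | refl ← ∷-injectiveˡ (∷-injectiveʳ r≡) =
      ⊥-elim (asym (All.head ≺e) (proj₂ (pops⇔ .to p)))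
    inner-preimage {τ} {b = b} {s′} (_ ∷ h′ ∷ u) τ≡ _ r≡ xzs≡
      with refl ← ∷-injectiveˡ r≡ | refl ← ∷-injectiveˡ (∷-injectiveʳ r≡) =
      there (subst₂ _∈_ (sym τ≡′) (cong (λ t′ → map (_∷ʳ e) (map (_∷ʳ h) (revInsertions c t′))) (sym t≡))
                    (∈-map⁺ (_∷ʳ e) (∈-map∷ʳ-revInsertions⁺ h u b s′)))
      where
      t≡ : t ≡ u ++ b ∷ s′
      t≡ = ∷-injectiveʳ (∷-injectiveʳ r≡)
      τ≡′ : τ ≡ ((b ∷ s′) ʳ++ (c ∷ reverse (h ∷ u))) ∷ʳ e
      τ≡′ = trans τ≡ (trans (cong (λ v → (b ∷ s′) ʳ++ (c ∷ v)) (trans xzs≡ (unfold-reverse e (h ∷ u))))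
                            (sym (ʳ++-++ (b ∷ s′) (c ∷ reverse (h ∷ u)) [ e ])))

  complete : ∀ {τ} → SC σ τ ≡ c ∷ e ∷ r → τ ∈ preimages
  complete {τ} eq with firstPop [] τ eq
  ... | no-pop out≡ = subst (_∈ preimages) (sym (reverse-≡ out≡)) (here refl)
  ... | pop ys x zs a b s′ τ≡ stack≡ p out≡ with refl , r≡ ← ∷-injective out≡
    with firstPop (b ∷ s′) (x ∷ zs) (sym r≡)
  ... | no-pop r≡′ =
    inner-preimage (reverse (x ∷ zs)) τ≡′ p (trans r≡′ (ʳ++-defn (x ∷ zs))) (sym (reverse-involutive (x ∷ zs)))
    where
    τ≡′ : τ ≡ (b ∷ s′) ʳ++ (c ∷ x ∷ zs)
    τ≡′ = trans τ≡ (trans (cong (_++ x ∷ zs) (reverse-≡ (sym stack≡))) (ʳ++-++ (b ∷ s′) [ c ] (x ∷ zs)))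
  -- A second pop would remove e, but every entry x′ still to be read lies ≺-below e.
  ... | pop _ x′ zs′ a′ b′ s″ _ _ p′ r≡′ with refl , r≡″ ← ∷-injective r≡′ =
    ⊥-elim (asym (All.lookup ≺e x′∈r) (proj₁ (pops⇔ .to p′)))
    where
    x′∈r : x′ ∈ r
    x′∈r = subst (x′ ∈_) (sym r≡″) (∈-run (b′ ∷ s″) (x′ ∷ zs′) (∈-++⁺ʳ (b′ ∷ s″) (here refl)))

  fertility : ∀ {m} → IsPerm m (c ∷ e ∷ r) → HasFertility σ m (c ∷ e ∷ r) (length r)
  fertility {m} perm = subst (HasFertility σ m (c ∷ e ∷ r)) length-preimages
    (hasFertility preimages unique perm sound complete)
    where
    c∉t : c ∉ t
    c∉t c∈t = irrefl refl (All.lookup (All.tail c≺) c∈t)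
    unique : Unique preimages
    unique = All.tabulate head≢ ∷ Unique.map⁺ (λ {u} {v} → proj₁ ∘ ∷ʳ-injective u v)
                                   (Unique.map⁺ (λ {u} {v} → proj₁ ∘ ∷ʳ-injective u v) (revInsertions-unique c∉t))
      where
      head≢ : ∀ {τ} → τ ∈ map (_∷ʳ e) (map (_∷ʳ h) (revInsertions c t)) → r ʳ++ (e ∷ c ∷ []) ≢ τ
      head≢ τ∈ eq with _ , _ , refl ← ∈-map⁻ (_∷ʳ e) τ∈ =
        irrefl (proj₂ (∷ʳ-injective (r ʳ++ [ e ]) _ (trans (ʳ++-++ r [ e ] [ c ]) eq))) c≺e
    length-preimages : length preimages ≡ length r
    length-preimages =
      trans (cong suc (length-map (_∷ʳ e) (map (_∷ʳ h) (revInsertions c t)))) (length-revInsertions c r)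

module MiddleTop {_≺_ : Rel ℕ 0ℓ} (≺-spo : IsStrictPartialOrder _≡_ _≺_)
  (σ : List ℕ) (pops⇔ : ∀ {x a b} → T (forms σ x a b) ⇔ (b ≺ a × a ≺ x)) {z : ℕ} where

  open IsStrictPartialOrder ≺-spo using (asym; irrefl)
  open StackSorting σ

  ¬pop : ∀ {x a b} → x ≺ a → ¬ T (forms σ x a b)
  ¬pop x≺a p = asym x≺a (proj₂ (pops⇔ .to p))

  sound-after-z : ∀ {r w} → AllPairs _≺_ r → All (z ≺_) r → w ∈ suffixReversals r → run σ [ z ] w ≡ r ∷ʳ z
  sound-after-z {h ∷ t} sorted _ (here refl) = begin
    run σ [ z ] (reverse (h ∷ t))  ≡⟨ run-noPop-all (noPop-fresh ¬pop (λ ()) (reverse (h ∷ t)) linked) ⟩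
    reverse (h ∷ t) ʳ++ [ z ]      ≡⟨ ʳ++-ʳ++ (h ∷ t) ⟩
    (h ∷ t) ∷ʳ z                   ∎
    where
    open ≡-Reasoning
    linked : Linked _≺_ (reverse (reverse (h ∷ t)))
    linked = subst (Linked _≺_) (sym (reverse-involutive (h ∷ t))) (AllPairs⇒Linked sorted)
  sound-after-z {h ∷ t} (h≺t ∷ sorted) (z≺h ∷ z≺t) (there w∈)
    with w′ , w′∈ , refl ← ∈-map⁻ (h ∷_) w∈
    with x , w″ , refl , x∈t ← ∈-suffixReversals-head w′∈ = begin
    run σ (h ∷ z ∷ []) (x ∷ w″)  ≡⟨ run-pop x h z [] w″ (pops⇔ .from (z≺h , All.lookup h≺t x∈t)) ⟩
    h ∷ run σ [ z ] (x ∷ w″)     ≡⟨ cong (h ∷_) (sound-after-z sorted z≺t w′∈) ⟩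
    h ∷ t ∷ʳ z                   ∎
    where open ≡-Reasoning

  second-is-z : ∀ {h t x zs b s′} → AllPairs _≺_ (h ∷ t) → T (forms σ x h b) →
                t ∷ʳ z ≡ run σ (b ∷ s′) (x ∷ zs) → b ≡ z
  second-is-z {t = t} {x} {zs} {b} {s′} (h≺t ∷ _) p rest≡
    with ∈-++⁻ t (subst (b ∈_) (sym rest≡) (∈-run (b ∷ s′) (x ∷ zs) (here refl)))
  ... | inj₁ b∈t      = ⊥-elim (asym (All.lookup h≺t b∈t) (proj₁ (pops⇔ .to p)))
  ... | inj₂ (here b≡z) = b≡z

  complete-after-z : ∀ {r y w} → AllPairs _≺_ r → All (z ≺_) r → y ∷ w ↭ r →
                     run σ [ z ] (y ∷ w) ≡ r ∷ʳ z → y ∷ w ∈ suffixReversals r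
  complete-after-z {[]} _ _ perm _ = ⊥-elim (¬x∷xs↭[] perm)
  complete-after-z {h ∷ t} {y} {w} sorted z≺ perm eq
    with firstPop (y ∷ z ∷ []) w eq
  ... | no-pop out≡ = here (reverse-≡ (∷ʳ-injectiveˡ (h ∷ t) _ (trans out≡ (sym (ʳ++-++ (y ∷ w) [] [ z ])))))
  ... | pop ys x zs a b s′ w≡ stack≡ p out≡
    with refl , rest≡ ← ∷-injective out≡
    with refl ← second-is-z {zs = zs} {s′ = s′} sorted p rest≡
    -- z is second on the stack at the first pop, so y is the only entry pushed above it.
    with ʳ++-second ys stack≡
  ... | inj₁ (refl , refl , _ , refl) with refl ← w≡ =
    there (∈-map⁺ (h ∷_) (complete-after-z (AllPairs.tail sorted) (All.tail z≺) (drop-∷ perm) (sym rest≡)))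
  ... | inj₂ z∈y∷ys = ⊥-elim (irrefl refl (All.lookup z≺ (∈-resp-↭ perm (z∈y∷w z∈y∷ys))))
    where
    z∈y∷w : z ∈ y ∷ ys → z ∈ y ∷ w
    z∈y∷w (here z≡y)   = here z≡y
    z∈y∷w (there z∈ys) = there (subst (z ∈_) (sym w≡) (∈-++⁺ˡ z∈ys))

  sound : ∀ {r τ} → AllPairs _≺_ r → All (z ≺_) r → τ ∈ map (z ∷_) (suffixReversals r) → SC σ τ ≡ r ∷ʳ z
  sound sorted z≺ τ∈ with w , w∈ , refl ← ∈-map⁻ (z ∷_) τ∈ = sound-after-z sorted z≺ w∈

  complete : ∀ {h t τ} → AllPairs _≺_ (h ∷ t) → All (z ≺_) (h ∷ t) → SC σ τ ≡ (h ∷ t) ∷ʳ z →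
             τ ∈ map (z ∷_) (suffixReversals (h ∷ t))
  complete {τ = []} _ _ ()
  complete {h} {t} {y ∷ τ} sorted z≺ eq
    with w , eq′ ← run-∷ʳ [] y τ
    with refl ← ∷ʳ-injectiveʳ w (h ∷ t) (trans (sym eq′) eq)
    with τ
  ... | []    = case ∷ʳ-injectiveˡ [] (h ∷ t) eq of λ ()
  ... | y′ ∷ w′ = ∈-map⁺ (z ∷_) (complete-after-z sorted z≺ (↭-sym (drop-∷ r↭)) eq)
    where
    r↭ : z ∷ h ∷ t ↭ z ∷ y′ ∷ w′
    r↭ = ↭-trans (∷↭∷ʳ z (h ∷ t)) (subst (_↭ z ∷ y′ ∷ w′) eq (run-↭ [ z ] (y′ ∷ w′)))

  fertility : ∀ {m h t} → AllPairs _≺_ (h ∷ t) → All (z ≺_) (h ∷ t) → IsPerm m ((h ∷ t) ∷ʳ z) →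
              HasFertility σ m ((h ∷ t) ∷ʳ z) (length (h ∷ t))
  fertility {m} {h} {t} sorted z≺ perm = subst (HasFertility σ m ((h ∷ t) ∷ʳ z)) length-preimages
    (hasFertility preimages unique perm (sound sorted z≺) (complete sorted z≺))
    where
    preimages : List (List ℕ)
    preimages = map (z ∷_) (suffixReversals (h ∷ t))
    unique : Unique preimages
    unique = Unique.map⁺ ∷-injectiveʳ (suffixReversals-unique (AllPairs.map (λ x≺y x≡y → irrefl x≡y x≺y) sorted))
    length-preimages : length preimages ≡ length (h ∷ t)
    length-preimages = trans (length-map (z ∷_) (suffixReversals (h ∷ t))) (length-suffixReversals (h ∷ t))

-- The six patterns

ascending : ∀ k n → AllPairs _<_ (map (k +_) (upTo n))
ascending k n = Linked⇒AllPairs <-trans (Linked-map⁺ (applyUpTo⁺₂ id n (λ i → +-monoʳ-< k (n<1+n i))))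

descending : ∀ k n → AllPairs _>_ (map (k +_) (downFrom n))
descending k n =
  Linked⇒AllPairs (λ x>y y>z → <-trans y>z x>y) (Linked-map⁺ (applyDownFrom⁺₂ id n (λ i → +-monoʳ-< k (n<1+n i))))

∈-ascending : ∀ {k n y} → y ∈ map (k +_) (upTo n) → k ≤ y × y < k + n
∈-ascending {k} y∈ with i , i∈ , refl ← ∈-map⁻ (k +_) y∈ = m≤m+n k i , +-monoʳ-< k (∈-upTo⁻ i∈)

∈-descending : ∀ {k n y} → y ∈ map (k +_) (downFrom n) → k ≤ y × y < k + n
∈-descending {k} y∈ with i , i∈ , refl ← ∈-map⁻ (k +_) y∈ = m≤m+n k i , +-monoʳ-< k (∈-downFrom⁻ i∈)

length-ascending : ∀ k n → length (map (k +_) (upTo n)) ≡ n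
length-ascending k n = trans (length-map (k +_) (upTo n)) (length-upTo n)

length-descending : ∀ k n → length (map (k +_) (downFrom n)) ≡ n
length-descending k n = trans (length-map (k +_) (downFrom n)) (length-downFrom n)

ascending-∷ʳ : ∀ k n → map (k +_) (upTo (suc n)) ≡ map (k +_) (upTo n) ∷ʳ (k + n)
ascending-∷ʳ k n = trans (cong (map (k +_)) (sym (upTo-∷ʳ n))) (map-++ (k +_) (upTo n) [ n ])

ascending-∷ : ∀ n → map (1 +_) (upTo (suc n)) ≡ 1 ∷ map (2 +_) (upTo n)
ascending-∷ n = cong (1 ∷_) (trans (map-applyUpTo suc (1 +_) n) (sym (map-upTo (2 +_) n)))

descending↭ascending : ∀ k n → map (k +_) (downFrom n) ↭ map (k +_) (upTo n)
descending↭ascending k n = subst (_↭ map (k +_) (upTo n)) reverse≡ (↭-reverse (map (k +_) (upTo n)))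
  where
  reverse≡ : reverse (map (k +_) (upTo n)) ≡ map (k +_) (downFrom n)
  reverse≡ = trans (sym (reverse-map (k +_) (upTo n))) (cong (map (k +_)) (reverse-upTo n))

FertilityNumber : List ℕ → ℕ → Set
FertilityNumber σ f = Σ ℕ λ m → 1 ≤ m × Σ (List ℕ) λ π → IsPerm m π × HasFertility σ m π f

fertilityNumber : ∀ {σ m π n f} → IsPerm (suc m) π → HasFertility σ (suc m) π n → n ≡ f → FertilityNumber σ f
fertilityNumber {σ} {m} {π} perm fertile n≡f =
  suc m , s≤s z≤n , π , perm , subst (HasFertility σ (suc m) π) n≡f fertile

>-isStrictPartialOrder : IsStrictPartialOrder _≡_ _>_
>-isStrictPartialOrder = Flip.isStrictPartialOrder <-isStrictPartialOrder

fertility-132 : ∀ n → FertilityNumber σ132 (suc n)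
fertility-132 n = fertilityNumber perm (A.fertility perm) (length-ascending 1 f)
  where
  f : ℕ
  f = suc n
  module A = MiddleSecond <-isStrictPartialOrder σ132 forms-132 {c = suc f}
                          (ascending 1 f) (All.tabulate (proj₂ ∘ ∈-ascending))
  perm : IsPerm (suc f) (suc f ∷ map (1 +_) (upTo f))
  perm = subst (suc f ∷ map (1 +_) (upTo f) ↭_) (sym (ascending-∷ʳ 1 f)) (∷↭∷ʳ (suc f) _)

fertility-312 : ∀ n → FertilityNumber σ312 (suc n)
fertility-312 n = fertilityNumber perm (A.fertility perm) (length-descending 2 f)
  where
  f : ℕ
  f = suc n
  module A = MiddleSecond >-isStrictPartialOrder σ312 forms-312 {c = 1}
                          (descending 2 f) (All.tabulate (proj₁ ∘ ∈-descending))
  perm : IsPerm (suc f) (1 ∷ map (2 +_) (downFrom f))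
  perm = subst (1 ∷ map (2 +_) (downFrom f) ↭_) (sym (ascending-∷ f)) (prep 1 (descending↭ascending 2 f))

1∷max∷ascending : ∀ f → IsPerm (2 + f) (1 ∷ (2 + f) ∷ map (2 +_) (upTo f))
1∷max∷ascending f = subst (1 ∷ (2 + f) ∷ map (2 +_) (upTo f) ↭_)
                          (trans (cong (1 ∷_) (sym (ascending-∷ʳ 2 f))) (sym (ascending-∷ (suc f))))
                          (prep 1 (∷↭∷ʳ (2 + f) (map (2 +_) (upTo f))))

fertility-213 : ∀ n → FertilityNumber σ213 (suc n)
fertility-213 n = fertilityNumber perm (B.fertility perm) (length-ascending 2 f)
  where
  f : ℕ
  f = suc n
  module B = MiddleIncoming <-isStrictPartialOrder σ213 forms-213 {c = 1} {e = 2 + f}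
                            (ascending 2 f) (All.tabulate (proj₁ ∘ ∈-ascending)) (All.tabulate (proj₂ ∘ ∈-ascending))
  perm : IsPerm (2 + f) (1 ∷ (2 + f) ∷ map (2 +_) (upTo f))
  perm = 1∷max∷ascending f

fertility-231 : ∀ n → FertilityNumber σ231 (suc n)
fertility-231 n = fertilityNumber perm (B.fertility perm) (length-descending 2 f)
  where
  f : ℕ
  f = suc n
  module B = MiddleIncoming >-isStrictPartialOrder σ231 forms-231 {c = 2 + f} {e = 1}
                            (descending 2 f) (All.tabulate (proj₂ ∘ ∈-descending)) (All.tabulate (proj₁ ∘ ∈-descending))
  perm : IsPerm (2 + f) ((2 + f) ∷ 1 ∷ map (2 +_) (downFrom f))
  perm = ↭-trans (swap (2 + f) 1 (descending↭ascending 2 f)) (1∷max∷ascending f)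

fertility-321 : ∀ n → FertilityNumber σ321 (suc n)
fertility-321 n =
  fertilityNumber perm (C.fertility (ascending 2 f) (All.tabulate (proj₁ ∘ ∈-ascending)) perm) (length-ascending 2 f)
  where
  f : ℕ
  f = suc n
  module C = MiddleTop <-isStrictPartialOrder σ321 forms-321 {z = 1}
  perm : IsPerm (suc f) (map (2 +_) (upTo f) ∷ʳ 1)
  perm = subst (map (2 +_) (upTo f) ∷ʳ 1 ↭_) (sym (ascending-∷ f)) (↭-sym (∷↭∷ʳ 1 (map (2 +_) (upTo f))))

fertility-123 : ∀ n → FertilityNumber σ123 (suc n)
fertility-123 n =
  fertilityNumber perm (C.fertility (descending 1 f) (All.tabulate (proj₂ ∘ ∈-descending)) perm) (length-descending 1 f)
  where
  f : ℕ
  f = suc n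
  module C = MiddleTop >-isStrictPartialOrder σ123 forms-123 {z = suc f}
  perm : IsPerm (suc f) (map (1 +_) (downFrom f) ∷ʳ suc f)
  perm = subst (map (1 +_) (downFrom f) ∷ʳ suc f ↭_) (sym (ascending-∷ʳ 1 f))
               (++⁺ʳ [ suc f ] (descending↭ascending 1 f))

S₃ : List (List ℕ)
S₃ = σ123 ∷ σ132 ∷ σ213 ∷ σ231 ∷ σ312 ∷ σ321 ∷ []

↭-pair : ∀ {b c u v : ℕ} → b ∷ c ∷ [] ↭ u ∷ v ∷ [] → (b ≡ u × c ≡ v) ⊎ (b ≡ v × c ≡ u)
↭-pair p with ∈-resp-↭ p (here refl)
... | here refl with refl ← ↭-singleton-inv (drop-∷ p) = inj₁ (refl , refl)
... | there (here refl) with refl ← ↭-singleton-inv (drop-mid [] [ _ ] p) = inj₂ (refl , refl)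

∈-S₃ : ∀ {σ} → IsPerm 3 σ → σ ∈ S₃
∈-S₃ {a ∷ b ∷ c ∷ []} p with ∈-resp-↭ p (here refl)
... | here refl with ↭-pair (drop-∷ p)
...   | inj₁ (refl , refl) = here refl
...   | inj₂ (refl , refl) = there (here refl)
∈-S₃ {a ∷ b ∷ c ∷ []} p | there (here refl) with ↭-pair (drop-mid [] [ 1 ] p)
...   | inj₁ (refl , refl) = there (there (here refl))
...   | inj₂ (refl , refl) = there (there (there (here refl)))
∈-S₃ {a ∷ b ∷ c ∷ []} p | there (there (here refl)) with ↭-pair (drop-mid [] (1 ∷ 2 ∷ []) p)
...   | inj₁ (refl , refl) = there (there (there (there (here refl))))
...   | inj₂ (refl , refl) = there (there (there (there (there (here refl)))))
∈-S₃ {[]}                  p with () ← ↭-length p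
∈-S₃ {_ ∷ []}              p with () ← ↭-length p
∈-S₃ {_ ∷ _ ∷ []}          p with () ← ↭-length p
∈-S₃ {_ ∷ _ ∷ _ ∷ _ ∷ _}   p with () ← ↭-length p

everyFertility : All (λ σ → ∀ n → FertilityNumber σ (suc n)) S₃
everyFertility = fertility-123 ∷ fertility-132 ∷ fertility-213 ∷ fertility-231 ∷ fertility-312 ∷ fertility-321 ∷ []

mainTheorem1 : (σ : List ℕ) → IsPerm 3 σ → (f : ℕ) → 1 ≤ f →
    Σ ℕ λ m → 1 ≤ m × Σ (List ℕ) λ π → IsPerm m π × HasFertility σ m π f
mainTheorem1 σ σ-perm (suc n) _ = All.lookup everyFertility (∈-S₃ σ-perm) n
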